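{- Let $H \in \mathcal C$. If a $\sigma$-type in $H$ contains a formula defining a countable subset of $H^n$, then it is isolated and hence realised in $H$.
   Context: Let $\mathcal L$ be a finitary language and $\mathcal C$ a quasiminimal pregeometry class of $\mathcal L$-structures (each $H\in\mathcal C$ equipped with a pregeometry $\mathrm{cl}_H$). For $H \in \mathcal C$, $A \subseteq H$ and a finite tuple of variables $\bar v$ of length $n$, a $\sigma$-type over $A$ in $\bar v$ is a set $p$ of $\mathcal L_{\omega_1,\omega}$-formulas with parameters from $A$ and free variables among $\bar v$ such that for every countable $\Phi \subseteq p$, $H \models \exists \bar v \bigwedge_{\phi \in \Phi} \phi(\bar v)$. It is isolated if there is a consistent $\mathcal L_{\omega_1,\omega}$-formula $\psi(\bar x)$ with $H \models \forall \bar x(\psi(\bar x) \to \phi(\bar x))$ for all $\phi \in p$; it is realised in $H$ if $\bigcap_{\phi \in p} \phi(H^n) \neq \emptyset$. -}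

module Defs where

open import Data.Nat using (ℕ; suc)
open import Data.Fin using (Fin)
open import Data.Vec using (Vec; lookup; _∷_)
open import Data.Product using (Σ; _×_; proj₁)
open import Relation.Binary.PropositionalEquality using (_≡_)
open import Relation.Nullary using (¬_)

record Language : Set₁ where
  field
    FunSym   : Set
    funArity : FunSym → ℕ
    RelSym   : Set
    relArity : RelSym → ℕ

module _ (L : Language) where
  open Language L

  -- L-structures (equality is interpreted as true equality _≡_).
  record Structure : Set₁ where
    field
      Carrier : Set
      funI    : (f : FunSym) → (Fin (funArity f) → Carrier) → Carrier
      relI    : (r : RelSym) → (Fin (relArity r) → Carrier) → Set

  data Term (Par : Set) (m : ℕ) : Set where
    var   : Fin m → Term Par m
    param : Par → Term Par m
    app   : (f : FunSym) → (Fin (funArity f) → Term Par m) → Term Par m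

  -- L_{ω₁,ω}-formulas with parameters from Par and free variables among
  -- v₀,…,v_{m-1} (de Bruijn).  Conjunctions are countable (indexed by ℕ;
  -- finite conjunctions arise by repetition).  Disjunction and ∀ are
  -- definable from ¬, ⋀, ∃.
  data Formula (Par : Set) (m : ℕ) : Set where
    _≐_  : Term Par m → Term Par m → Formula Par m
    rel  : (r : RelSym) → (Fin (relArity r) → Term Par m) → Formula Par m
    neg  : Formula Par m → Formula Par m
    conj : (ℕ → Formula Par m) → Formula Par m
    ex   : Formula Par (suc m) → Formula Par m

  module _ (H : Structure) where
    open Structure H

    Params : (Carrier → Set) → Set
    Params A = Σ Carrier A

    evalT : {A : Carrier → Set} {m : ℕ} → Term (Params A) m → Vec Carrier m → Carrier
    evalT (var i)   ρ = lookup ρ i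
    evalT (param a) ρ = proj₁ a
    evalT (app f t) ρ = funI f (λ i → evalT (t i) ρ)

    Sat : {A : Carrier → Set} {m : ℕ} → Formula (Params A) m → Vec Carrier m → Set
    Sat (s ≐ t)   ρ = evalT s ρ ≡ evalT t ρ
    Sat (rel r t) ρ = relI r (λ i → evalT (t i) ρ)
    Sat (neg φ)   ρ = ¬ Sat φ ρ
    Sat (conj φ)  ρ = (i : ℕ) → Sat (φ i) ρ
    Sat (ex φ)    ρ = Σ Carrier λ a → Sat φ (a ∷ ρ)

    IsSigmaType : (A : Carrier → Set) (n : ℕ) → (Formula (Params A) n → Set) → Set
    IsSigmaType A n p =
      (Φ : ℕ → Formula (Params A) n) → ((i : ℕ) → p (Φ i)) →
      Σ (Vec Carrier n) λ a → (i : ℕ) → Sat (Φ i) a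

    Isolated : (A : Carrier → Set) (n : ℕ) → (Formula (Params A) n → Set) → Set
    Isolated A n p =
      Σ (Formula (Params A) n) λ ψ →
        (Σ (Vec Carrier n) λ a → Sat ψ a) ×
        ((φ : Formula (Params A) n) → p φ → (a : Vec Carrier n) → Sat ψ a → Sat φ a)

    Realised : (A : Carrier → Set) (n : ℕ) → (Formula (Params A) n → Set) → Set
    Realised A n p =
      Σ (Vec Carrier n) λ a → (φ : Formula (Params A) n) → p φ → Sat φ a

    DefinesCountable : {A : Carrier → Set} {n : ℕ} → Formula (Params A) n → Set
    DefinesCountable {n = n} φ =
      Σ (ℕ → Vec Carrier n) λ f →
        (a : Vec Carrier n) → Sat φ a → Σ ℕ λ i → f i ≡ a

-- For each point bᵢ of the countable set φ(Hⁿ) choose χᵢ ∈ p false at bᵢ when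
-- such a formula exists.  The countable conjunction ψ = φ ∧ ⋀ᵢ χᵢ of members of
-- p is consistent because p is a σ-type.  A realisation of ψ lies in φ(Hⁿ), so it
-- is some bᵢ; it satisfies χᵢ, hence nothing in p is false at it.  Thus ψ
-- isolates p.
module Submission where

open import Defs
open import Data.Nat using (ℕ; zero; suc)
open import Data.Product using (Σ; _×_; _,_; proj₁; proj₂)
open import Data.Sum using (_⊎_; inj₁; inj₂)
open import Data.Vec using (Vec)
open import Data.Empty using (⊥-elim)
open import Relation.Nullary using (yes; no; ¬_)
open import Relation.Binary.PropositionalEquality using (subst; sym)
open import Level using (0ℓ)
open import Axiom.ExcludedMiddle using (ExcludedMiddle)

module _ (L : Language) (H : Structure L) {A : Structure.Carrier H → Set} {n : ℕ}
         (p : Formula L (Params L H A) n → Set) where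
  open Structure H

  private
    Fm : Set
    Fm = Formula L (Params L H A) n

  RealisedAt : Vec Carrier n → Set
  RealisedAt b = (φ : Fm) → p φ → Sat L H φ b

  RefutedAt : Vec Carrier n → Set
  RefutedAt b = Σ Fm λ χ → p χ × ¬ Sat L H χ b

  isolated⇒realised : Isolated L H A n p → Realised L H A n p
  isolated⇒realised (ψ , (a , ψa) , ψ⇒p) = a , λ φ pφ → ψ⇒p φ pφ a ψa

  realisedAt⊎refutedAt : ExcludedMiddle 0ℓ → (b : Vec Carrier n) → RealisedAt b ⊎ RefutedAt b
  realisedAt⊎refutedAt lem b with lem {RefutedAt b}
  ... | yes refuted = inj₂ refuted
  ... | no ¬refuted = inj₁ realised
    where
    realised : RealisedAt b
    realised φ pφ with lem {Sat L H φ b}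
    ... | yes φb = φb
    ... | no ¬φb = ⊥-elim (¬refuted (φ , pφ , ¬φb))

  testFormula : ExcludedMiddle 0ℓ → (φ : Fm) → p φ → (b : Vec Carrier n) →
                Σ Fm λ χ → p χ × (Sat L H χ b → RealisedAt b)
  testFormula lem φ pφ b with realisedAt⊎refutedAt lem b
  ... | inj₁ realised       = φ , pφ , λ _ → realised
  ... | inj₂ (χ , pχ , ¬χb) = χ , pχ , λ χb → ⊥-elim (¬χb χb)

  countable-member⇒isolated : ExcludedMiddle 0ℓ → IsSigmaType L H A n p →
    (φ : Fm) → p φ → DefinesCountable L H φ → Isolated L H A n p
  countable-member⇒isolated lem sig φ pφ (b , φ⊆b) =
    conj Φ , sig Φ Φ⊆p , ψ⇒p
    where
    test : (i : ℕ) → Σ Fm λ χ → p χ × (Sat L H χ (b i) → RealisedAt (b i))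
    test i = testFormula lem φ pφ (b i)

    Φ : ℕ → Fm
    Φ zero    = φ
    Φ (suc i) = proj₁ (test i)

    Φ⊆p : (i : ℕ) → p (Φ i)
    Φ⊆p zero    = pφ
    Φ⊆p (suc i) = proj₁ (proj₂ (test i))

    ψ⇒p : (χ : Fm) → p χ → (a : Vec Carrier n) → Sat L H (conj Φ) a → Sat L H χ a
    ψ⇒p χ pχ a ψa with φ⊆b a (ψa zero)
    ... | i , bi≡a = subst (Sat L H χ) bi≡a (bi-realised χ pχ)
      where
      bi-realised : RealisedAt (b i)
      bi-realised = proj₂ (proj₂ (test i)) (subst (Sat L H (Φ (suc i))) (sym bi≡a) (ψa (suc i)))

proposition7 : ExcludedMiddle 0ℓ →
    (L : Language) (H : Structure L) (A : Structure.Carrier H → Set) (n : ℕ)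
    (p : Formula L (Params L H A) n → Set) →
    IsSigmaType L H A n p →
    (Σ (Formula L (Params L H A) n) λ φ → p φ × DefinesCountable L H φ) →
    Isolated L H A n p × Realised L H A n p
proposition7 lem L H A n p sig (φ , pφ , φ-countable) = isolated , isolated⇒realised L H p isolated
  where
  isolated : Isolated L H A n p
  isolated = countable-member⇒isolated L H p lem sig φ pφ φ-countable
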